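{- Let $\mathbf A$ be a Łukasiewicz near semiring and $\theta$ a congruence on $\mathbf A$. Then $[0]_\theta$ is an ideal of $\mathbf A$.
   Context: An $\iota$-near semiring is an algebra $\langle A,+,\cdot,{}^{\alpha},0,1\rangle$ of type $\langle 2,2,1,0,0\rangle$ such that $\langle A,+\rangle$ is a join semilattice with least element $0$ and greatest element $1$ (order $x\le y$ iff $x+y=y$), $x\cdot1=x=1\cdot x$, $(x+y)\cdot z=xz+yz$, $x0=0x=0$, $(x^{\alpha})^{\alpha}=x$, and $x\le y$ implies $y^{\alpha}\le x^{\alpha}$. A Łukasiewicz near semiring is an $\iota$-near semiring satisfying $(x y^{\alpha})^{\alpha} y^{\alpha}=(y x^{\alpha})^{\alpha} x^{\alpha}$. Juxtaposition $xy$ denotes $x\cdot y$. An ideal of a Łukasiewicz near semiring $\mathbf A$ is a set $I\subseteq A$ with $0\in I$ such that (I1) if $ab^{\alpha}\in I$ and $b\in I$ then $a\in I$; (I2) if $a^{\alpha}b\in I$ and $b^{\alpha}a\in I$ then $(ac)^{\alpha}(bc)\in I$ and $(ca)^{\alpha}(cb)\in I$ for every $c\in A$. -}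

module Defs where

open import Level using (Level; _⊔_; suc)
open import Relation.Binary.PropositionalEquality using (_≡_)
open import Relation.Binary.Core using (Rel)
open import Relation.Binary.Structures using (IsEquivalence)
open import Relation.Unary using (Pred; _∈_)
open import Data.Product using (_×_)

record IotaNearSemiring (a : Level) : Set (suc a) where
  infixl 6 _+_
  infixl 7 _·_
  field
    Carrier : Set a
    _+_     : Carrier → Carrier → Carrier
    _·_     : Carrier → Carrier → Carrier
    _ᵅ      : Carrier → Carrier
    𝟘       : Carrier
    𝟙       : Carrier

  _≤_ : Carrier → Carrier → Set a
  x ≤ y = x + y ≡ y

  field
    +-assoc : ∀ x y z → (x + y) + z ≡ x + (y + z)
    +-comm  : ∀ x y → x + y ≡ y + x
    +-idem  : ∀ x → x + x ≡ x
    𝟘-least    : ∀ x → 𝟘 ≤ x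
    𝟙-greatest : ∀ x → x ≤ 𝟙
    ·-identityʳ : ∀ x → x · 𝟙 ≡ x
    ·-identityˡ : ∀ x → 𝟙 · x ≡ x
    ·-distribʳ-+ : ∀ x y z → (x + y) · z ≡ x · z + y · z
    ·-zeroʳ : ∀ x → x · 𝟘 ≡ 𝟘
    ·-zeroˡ : ∀ x → 𝟘 · x ≡ 𝟘
    ᵅ-involutive : ∀ x → (x ᵅ) ᵅ ≡ x
    ᵅ-antitone : ∀ x y → x ≤ y → (y ᵅ) ≤ (x ᵅ)

record ŁukasiewiczNearSemiring (a : Level) : Set (suc a) where
  field
    iotaNearSemiring : IotaNearSemiring a
  open IotaNearSemiring iotaNearSemiring public
  field
    łukasiewicz : ∀ x y → ((x · (y ᵅ)) ᵅ) · (y ᵅ) ≡ ((y · (x ᵅ)) ᵅ) · (x ᵅ)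

module _ {a : Level} (L : ŁukasiewiczNearSemiring a) where
  open ŁukasiewiczNearSemiring L

  -- A congruence: an equivalence relation compatible with +, ·, α
  -- (compatibility with the constants is automatic).
  record IsCongruence {ℓ : Level} (θ : Rel Carrier ℓ) : Set (a ⊔ ℓ) where
    field
      isEquivalence : IsEquivalence θ
      +-cong : ∀ {x x′ y y′} → θ x x′ → θ y y′ → θ (x + y) (x′ + y′)
      ·-cong : ∀ {x x′ y y′} → θ x x′ → θ y y′ → θ (x · y) (x′ · y′)
      ᵅ-cong : ∀ {x x′} → θ x x′ → θ (x ᵅ) (x′ ᵅ)

  [_]_ : ∀ {ℓ} → Carrier → Rel Carrier ℓ → Pred Carrier ℓ
  [ x ] θ = λ y → θ x y

  record IsIdeal {ℓ : Level} (I : Pred Carrier ℓ) : Set (a ⊔ ℓ) where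
    field
      zero∈ : 𝟘 ∈ I
      I1 : ∀ {x y} → (x · (y ᵅ)) ∈ I → y ∈ I → x ∈ I
      I2 : ∀ {x y} → ((x ᵅ) · y) ∈ I → ((y ᵅ) · x) ∈ I →
           ∀ c → (((x · c) ᵅ) · (y · c)) ∈ I × (((c · x) ᵅ) · (c · y)) ∈ I

-- In any ι-near semiring the involution α swaps the bounds
-- (0ᵅ = 1, 1ᵅ = 0).  The Łukasiewicz identity taken at y = 1 then gives
-- x·xᵅ = 0, and taken at the pair xᵅ, yᵅ it gives the symmetric law
-- (xᵅy)ᵅ·y = (yᵅx)ᵅ·x.  Now let θ be a congruence and write u ~ 0 for u θ 0.
--   * If u ~ 0 then uᵅ·x ~ 0ᵅ·x = x ("multiplying by the complement of a
--     θ-null element is invisible").  Combined with the symmetric law this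
--     shows: xᵅ·y ~ 0 and yᵅ·x ~ 0 imply x θ y.
--   * (I1): x = x·0ᵅ θ x·yᵅ θ 0 whenever y θ 0.
--   * (I2): from x θ y we get (xc)ᵅ·(yc) θ (yc)ᵅ·(yc) = 0, and likewise for
--     left multiplication by c.
module Submission where

open import Defs
open import Level using (Level)
open import Relation.Binary.Core using (Rel)
open import Relation.Binary.Structures using (IsEquivalence)
open import Relation.Binary.PropositionalEquality
  using (_≡_; refl; sym; trans; cong; subst; subst₂; module ≡-Reasoning)
open import Data.Product using (_,_)

module IotaFacts {a : Level} (S : IotaNearSemiring a) where
  open IotaNearSemiring S

  -- Antitonicity plus involutivity: α maps the least element to the greatest.
  𝟘ᵅ≡𝟙 : 𝟘 ᵅ ≡ 𝟙
  𝟘ᵅ≡𝟙 = begin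
      𝟘 ᵅ        ≡⟨ sym 𝟙≤𝟘ᵅ ⟩
      𝟙 + 𝟘 ᵅ    ≡⟨ +-comm 𝟙 (𝟘 ᵅ) ⟩
      𝟘 ᵅ + 𝟙    ≡⟨ 𝟙-greatest (𝟘 ᵅ) ⟩
      𝟙          ∎
    where
    open ≡-Reasoning
    -- 𝟘 ≤ 𝟙ᵅ, hence 𝟙 = 𝟙ᵅᵅ ≤ 𝟘ᵅ
    𝟙≤𝟘ᵅ : 𝟙 ≤ (𝟘 ᵅ)
    𝟙≤𝟘ᵅ = subst (λ z → z ≤ (𝟘 ᵅ)) (ᵅ-involutive 𝟙) (ᵅ-antitone 𝟘 (𝟙 ᵅ) (𝟘-least (𝟙 ᵅ)))

  𝟙ᵅ≡𝟘 : 𝟙 ᵅ ≡ 𝟘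
  𝟙ᵅ≡𝟘 = begin
      𝟙 ᵅ        ≡⟨ cong _ᵅ (sym 𝟘ᵅ≡𝟙) ⟩
      𝟘 ᵅ ᵅ      ≡⟨ ᵅ-involutive 𝟘 ⟩
      𝟘          ∎
    where open ≡-Reasoning

module ŁukasiewiczFacts {a : Level} (L : ŁukasiewiczNearSemiring a) where
  open ŁukasiewiczNearSemiring L
  open IotaFacts iotaNearSemiring public

  -- An element annihilates its complement on the right: the Łukasiewicz
  -- identity at y = 1.
  x·xᵅ≡𝟘 : ∀ x → x · (x ᵅ) ≡ 𝟘
  x·xᵅ≡𝟘 x = begin
      x · (x ᵅ)                      ≡⟨ cong (_· (x ᵅ)) (sym (ᵅ-involutive x)) ⟩
      ((x ᵅ) ᵅ) · (x ᵅ)              ≡⟨ cong (λ v → (v ᵅ) · (x ᵅ)) (sym (·-identityˡ (x ᵅ))) ⟩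
      ((𝟙 · (x ᵅ)) ᵅ) · (x ᵅ)        ≡⟨ sym (łukasiewicz x 𝟙) ⟩
      ((x · (𝟙 ᵅ)) ᵅ) · (𝟙 ᵅ)        ≡⟨ cong (((x · (𝟙 ᵅ)) ᵅ) ·_) 𝟙ᵅ≡𝟘 ⟩
      ((x · (𝟙 ᵅ)) ᵅ) · 𝟘            ≡⟨ ·-zeroʳ _ ⟩
      𝟘                              ∎
    where open ≡-Reasoning

  xᵅ·x≡𝟘 : ∀ x → (x ᵅ) · x ≡ 𝟘
  xᵅ·x≡𝟘 x = subst (λ z → (x ᵅ) · z ≡ 𝟘) (ᵅ-involutive x) (x·xᵅ≡𝟘 (x ᵅ))

  łukasiewicz-sym : ∀ x y → (((y ᵅ) · x) ᵅ) · x ≡ (((x ᵅ) · y) ᵅ) · y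
  łukasiewicz-sym x y =
    sym (subst₂ (λ u v → (((x ᵅ) · v) ᵅ) · v ≡ (((y ᵅ) · u) ᵅ) · u)
                (ᵅ-involutive x) (ᵅ-involutive y) (łukasiewicz (x ᵅ) (y ᵅ)))

module CongruenceFacts {a ℓ : Level} (L : ŁukasiewiczNearSemiring a)
  (θ : Rel (ŁukasiewiczNearSemiring.Carrier L) ℓ) (C : IsCongruence L θ) where
  open ŁukasiewiczNearSemiring L
  open ŁukasiewiczFacts L
  open IsCongruence C
  open IsEquivalence isEquivalence renaming (refl to θ-refl; sym to θ-sym; trans to θ-trans)

  ≡⇒θ : ∀ {x y} → x ≡ y → θ x y
  ≡⇒θ refl = θ-refl

  -- Left multiplication by the complement of a θ-null element is θ-invisible:
  -- uᵅ·x θ 0ᵅ·x = 1·x = x.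
  null-complement-·ˡ : ∀ {u} x → θ 𝟘 u → θ ((u ᵅ) · x) x
  null-complement-·ˡ x u~𝟘 =
    θ-trans (·-cong (ᵅ-cong (θ-sym u~𝟘)) θ-refl)
            (≡⇒θ (trans (cong (_· x) 𝟘ᵅ≡𝟙) (·-identityˡ x)))

  null-complement-·ʳ : ∀ {u} x → θ 𝟘 u → θ (x · (u ᵅ)) x
  null-complement-·ʳ x u~𝟘 =
    θ-trans (·-cong θ-refl (ᵅ-cong (θ-sym u~𝟘)))
            (≡⇒θ (trans (cong (x ·_) 𝟘ᵅ≡𝟙) (·-identityʳ x)))

  -- Two elements whose mutual "differences" xᵅy and yᵅx are θ-null are
  -- θ-related: x θ (yᵅx)ᵅx = (xᵅy)ᵅy θ y.
  null-differences⇒θ : ∀ {x y} → θ 𝟘 ((x ᵅ) · y) → θ 𝟘 ((y ᵅ) · x) → θ x y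
  null-differences⇒θ {x} {y} xᵅy~𝟘 yᵅx~𝟘 =
    θ-trans (θ-sym (null-complement-·ˡ x yᵅx~𝟘))
      (θ-trans (≡⇒θ (łukasiewicz-sym x y)) (null-complement-·ˡ y xᵅy~𝟘))

  -- If x θ y then the difference xᵅy is θ-null, since it is θ-related to yᵅy = 0.
  θ⇒null-difference : ∀ {x y} → θ x y → θ 𝟘 ((x ᵅ) · y)
  θ⇒null-difference {x} {y} x~y =
    θ-sym (θ-trans (·-cong (ᵅ-cong x~y) θ-refl) (≡⇒θ (xᵅ·x≡𝟘 y)))

theorem1 : ∀ {a ℓ : Level} (L : ŁukasiewiczNearSemiring a) →
    (θ : Rel (ŁukasiewiczNearSemiring.Carrier L) ℓ) →
    IsCongruence L θ →
    IsIdeal L ([_]_ L (ŁukasiewiczNearSemiring.𝟘 L) θ)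
theorem1 L θ C = record
  { zero∈ = θ-refl
    -- x θ x·yᵅ θ 0
  ; I1    = λ {x} xyᵅ~𝟘 y~𝟘 → θ-trans xyᵅ~𝟘 (null-complement-·ʳ x y~𝟘)
    -- x θ y, hence xc θ yc and cx θ cy, so both differences are θ-null
  ; I2    = λ xᵅy~𝟘 yᵅx~𝟘 c →
      let x~y = null-differences⇒θ xᵅy~𝟘 yᵅx~𝟘 in
      θ⇒null-difference (·-cong x~y θ-refl) , θ⇒null-difference (·-cong θ-refl x~y)
  }
  where
  open IsCongruence C using (isEquivalence; ·-cong)
  open IsEquivalence isEquivalence using () renaming (refl to θ-refl; trans to θ-trans)
  open CongruenceFacts L θ C
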